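{- Let $m,d,e\geq 1$ and let $S_d(x):=\sum_{f\mid d}\mu(f)x^{d/f}\in\mathbb{Z}[x]$. (1) If $d$ and $e$ are primewise congruent modulo $m$, then $S_d(x)\equiv S_e(x)\bmod x^m-1$. (2) If $d$ and $e$ are primewise congruent modulo $2m$, then $S_d(x)\equiv S_e(x)\bmod x^m+1$.
   Context: $\mu$ is the Möbius function. Positive integers $d,e$ are primewise congruent modulo $m$ if $d=p_1^{e_1}\cdots p_k^{e_k}$ and $e=q_1^{f_1}\cdots q_k^{f_k}$ for some $k\geq1$ and primes $p_i,q_i$ with $e_i=f_i$ and $p_i\equiv q_i\bmod m$ for each $i$, and $p_i\neq p_j$, $q_i\neq q_j$ for $i\neq j$. Congruence of polynomials modulo $g(x)$ means the difference is divisible by $g(x)$ in $\mathbb{Z}[x]$. -}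

module Defs where

open import Data.Nat as ℕ using (ℕ; zero; suc; _≤_)
open import Data.Nat.Divisibility using (_∣_; _∣?_)
open import Data.Nat.DivMod using (_/_)
open import Data.Nat.Primality using (Prime; prime?)
open import Data.Integer as ℤ using (ℤ; +_)
import Data.Integer.Divisibility as ℤD
open import Data.List using (List; []; _∷_; map; filter; length; upTo; replicate; _++_; foldr)
open import Data.Fin using (Fin; zero; suc)
open import Data.Bool using (if_then_else_)
open import Data.Product using (Σ; ∃; _×_)
open import Relation.Nullary using (¬_; ⌊_⌋)
open import Relation.Nullary.Decidable using (_×-dec_; ¬?)
open import Relation.Binary.PropositionalEquality using (_≡_)
open import Function.Definitions using (Injective)

ω : ℕ → ℕ
ω n = length (filter (λ p → prime? p ×-dec (p ∣? n)) (upTo (suc n)))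

squarefree : ℕ → Data.Bool.Bool
squarefree n = ⌊ length (filter (λ i → (suc (suc i) ℕ.* suc (suc i)) ∣? n) (upTo n)) ℕ.≟ 0 ⌋

μ : ℕ → ℤ
μ n = if squarefree n then (ℤ.-1ℤ ℤ.^ ω n) else ℤ.0ℤ

-- Polynomials in ℤ[x] as coefficient lists (lowest degree first).

Poly : Set
Poly = List ℤ

coeff : Poly → ℕ → ℤ
coeff []       _       = ℤ.0ℤ
coeff (a ∷ p)  zero    = a
coeff (a ∷ p)  (suc n) = coeff p n

infixl 6 _+ₚ_ _-ₚ_
infixl 7 _*ₚ_

_+ₚ_ : Poly → Poly → Poly
[]      +ₚ q       = q
(a ∷ p) +ₚ []      = a ∷ p
(a ∷ p) +ₚ (b ∷ q) = (a ℤ.+ b) ∷ (p +ₚ q)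

-ₚ_ : Poly → Poly
-ₚ p = map ℤ.-_ p

_-ₚ_ : Poly → Poly → Poly
p -ₚ q = p +ₚ (-ₚ q)

_*ₚ_ : Poly → Poly → Poly
[]      *ₚ q = []
(a ∷ p) *ₚ q = map (a ℤ.*_) q +ₚ (ℤ.0ℤ ∷ (p *ₚ q))

monomial : ℤ → ℕ → Poly
monomial c k = replicate k ℤ.0ℤ ++ (c ∷ [])

_≈ₚ_ : Poly → Poly → Set
p ≈ₚ q = ∀ n → coeff p n ≡ coeff q n

_∣ₚ_ : Poly → Poly → Set
g ∣ₚ p = Σ Poly (λ h → p ≈ₚ (g *ₚ h))

_≡ₚ_[mod_] : Poly → Poly → Poly → Set
p ≡ₚ q [mod g ] = g ∣ₚ (p -ₚ q)

xᵐ-1 : ℕ → Poly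
xᵐ-1 m = monomial (+ 1) m -ₚ monomial (+ 1) 0

xᵐ+1 : ℕ → Poly
xᵐ+1 m = monomial (+ 1) m +ₚ monomial (+ 1) 0

-- S_d(x) = Σ_{f ∣ d} μ(f) x^{d/f}; the divisors f of d ≥ 1 are among 1..d
S : ℕ → Poly
S d = foldr _+ₚ_ [] (map term (upTo d))
  where
  term : ℕ → Poly
  term i with suc i ∣? d
  ... | Relation.Nullary.yes _ = monomial (μ (suc i)) (d / suc i)
  ... | Relation.Nullary.no  _ = []

prodFin : (k : ℕ) → (Fin k → ℕ) → ℕ
prodFin zero    f = 1
prodFin (suc k) f = f zero ℕ.* prodFin k (λ i → f (suc i))

_≡_[modℕ_] : ℕ → ℕ → ℕ → Set
a ≡ b [modℕ m ] = (+ m) ℤD.∣ ((+ a) ℤ.- (+ b))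

PrimewiseCongruent : ℕ → ℕ → ℕ → Set
PrimewiseCongruent m d e =
  Σ ℕ λ k → 1 ≤ k ×
  Σ (Fin k → ℕ) λ p → Σ (Fin k → ℕ) λ q → Σ (Fin k → ℕ) λ ex →
    (∀ i → Prime (p i)) × (∀ i → Prime (q i)) ×
    Injective _≡_ _≡_ p × Injective _≡_ _≡_ q ×
    (∀ i → p i ≡ q i [modℕ m ]) ×
    d ≡ prodFin k (λ i → p i ℕ.^ ex i) ×
    e ≡ prodFin k (λ i → q i ℕ.^ ex i)

module Submission where

-- Write g = x^m + s (s = -1 or s = 1) and t = -s, so x^m ≡ t modulo g.  The
-- r-th residue of a polynomial P (r < m) is Σ_j t^j · coeff P (r + j m); P is
-- divisible by g iff all its residues vanish (the quotient is written down
-- explicitly).  The r-th residue of x^K is a function Φ_r(K) with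
-- Φ_r(K + m) = t · Φ_r(K), hence Φ_r has period M = m (t = 1) or M = 2m
-- (t = -1).  The r-th residue of S_d is the Möbius sum
--   T_d(φ) = Σ_{f ∣ d} μ(f) φ(d/f)      at φ = Φ_r,
-- so it suffices that T_d(φ) = T_e(φ) for every M-periodic φ whenever d and e
-- are primewise congruent mod M.  That follows by induction on the number of
-- prime powers from the recursion (p prime, p ∤ d')
--   T_{p^{b+1} d'}(φ) = T_{d'}(φ(p^{b+1} ·)) - T_{d'}(φ(p^b ·)),
-- a consequence of μ(p f) = -μ(f) for p ∤ f and μ(f) = 0 for p² ∣ f, together
-- with the fact that φ(c ·) depends only on c mod M.

open import Defs
open import Data.Nat as ℕ using (ℕ; zero; suc; _≤_; _<_; z≤n; s≤s; NonZero)
import Data.Nat.Properties as ℕP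
open import Data.Nat.Divisibility hiding (quotient)
open import Data.Nat.DivMod
  using (_/_; _%_; m/n≤m; *-/-assoc; /-congˡ; m*n/o*n≡m/o; %-distribˡ-*; [m+kn]%n≡m%n;
         m≡m%n+[m/n]*n; %-remove-+ʳ)
open import Data.Nat.Primality
  using (Prime; prime?; euclidsLemma; prime⇒irreducible; prime⇒nonZero; prime⇒nonTrivial)
open import Data.Nat.Coprimality using (Coprime; coprime-divisor)
open import Data.Integer as ℤ using (ℤ; +_; 0ℤ; 1ℤ; -1ℤ; _+_; _*_; -_)
import Data.Integer.Properties as ℤP
open import Data.Integer.Tactic.RingSolver using (solve-∀)
open import Data.List using ([]; _∷_; _++_; replicate; applyUpTo; upTo; filter; length; map; foldr)
open import Data.List.Properties using (map-cong; filter-none; filter-some)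
open import Data.List.Relation.Unary.All.Properties using (applyUpTo⁺₁)
open import Data.List.Relation.Unary.Any.Properties using (applyUpTo⁺)
open import Data.Fin using (Fin)
import Data.Fin.Properties as FinP
open import Data.Bool using (Bool; true; false; if_then_else_)
open import Data.Product using (_×_; _,_)
open import Data.Sum using (inj₁; inj₂)
open import Data.Empty using (⊥-elim)
open import Relation.Nullary using (Dec; yes; no; ¬_; ⌊_⌋)
open import Relation.Nullary.Decidable using (_×-dec_)
open import Relation.Unary using (Pred; Decidable)
open import Relation.Binary.PropositionalEquality
open import Function using (_∘_)
open import Function.Definitions using (Injective)

open ≡-Reasoning

+-interchange : ∀ a b c d → (a + b) + (c + d) ≡ (a + c) + (b + d)
+-interchange = solve-∀

-- Finite sums

∑ : ℕ → (ℕ → ℤ) → ℤ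
∑ zero    F = 0ℤ
∑ (suc n) F = F 0 + ∑ n (λ i → F (suc i))

∑-ext : ∀ n {F G : ℕ → ℤ} → (∀ i → i < n → F i ≡ G i) → ∑ n F ≡ ∑ n G
∑-ext zero    h = refl
∑-ext (suc n) h = cong₂ _+_ (h 0 (s≤s z≤n)) (∑-ext n (λ i i<n → h (suc i) (s≤s i<n)))

∑-zero : ∀ n {F : ℕ → ℤ} → (∀ i → i < n → F i ≡ 0ℤ) → ∑ n F ≡ 0ℤ
∑-zero zero    h = refl
∑-zero (suc n) h = cong₂ _+_ (h 0 (s≤s z≤n)) (∑-zero n (λ i i<n → h (suc i) (s≤s i<n)))

∑-+ : ∀ n (F G : ℕ → ℤ) → ∑ n (λ i → F i + G i) ≡ ∑ n F + ∑ n G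
∑-+ zero    F G = refl
∑-+ (suc n) F G =
  trans (cong (_+_ (F 0 + G 0)) (∑-+ n (λ i → F (suc i)) (λ i → G (suc i))))
        (+-interchange (F 0) (G 0) _ _)

∑-neg : ∀ n (F : ℕ → ℤ) → ∑ n (λ i → - F i) ≡ - ∑ n F
∑-neg zero    F = refl
∑-neg (suc n) F =
  trans (cong (_+_ (- F 0)) (∑-neg n (λ i → F (suc i)))) (sym (ℤP.neg-distrib-+ (F 0) _))

∑-split : ∀ a b (F : ℕ → ℤ) → ∑ (a ℕ.+ b) F ≡ ∑ a F + ∑ b (λ i → F (a ℕ.+ i))
∑-split zero    b F = sym (ℤP.+-identityˡ _)
∑-split (suc a) b F =
  trans (cong (_+_ (F 0)) (∑-split a b (λ i → F (suc i)))) (sym (ℤP.+-assoc (F 0) _ _))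

∑-truncate : ∀ {a b} (F : ℕ → ℤ) → (∀ i → a ≤ i → F i ≡ 0ℤ) → a ≤ b → ∑ b F ≡ ∑ a F
∑-truncate {a} {b} F h a≤b = begin
  ∑ b F                                    ≡⟨ cong (λ n → ∑ n F) (sym (ℕP.m+[n∸m]≡n a≤b)) ⟩
  ∑ (a ℕ.+ (b ℕ.∸ a)) F                    ≡⟨ ∑-split a (b ℕ.∸ a) F ⟩
  ∑ a F + ∑ (b ℕ.∸ a) (λ i → F (a ℕ.+ i))  ≡⟨ cong (_+_ (∑ a F)) (∑-zero (b ℕ.∸ a) (λ i _ → h (a ℕ.+ i) (ℕP.m≤m+n a i))) ⟩
  ∑ a F + 0ℤ                               ≡⟨ ℤP.+-identityʳ _ ⟩
  ∑ a F                                    ∎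

∑-multiples : ∀ p .{{_ : NonZero p}} B (F : ℕ → ℤ) → (∀ i → ¬ p ∣ i → F i ≡ 0ℤ) →
  ∑ (B ℕ.* p) F ≡ ∑ B (λ j → F (j ℕ.* p))
∑-multiples p        zero    F h = refl
∑-multiples (suc p') (suc B) F h = begin
  ∑ (suc p' ℕ.+ B ℕ.* suc p') F
    ≡⟨ ∑-split (suc p') (B ℕ.* suc p') F ⟩
  F 0 + ∑ p' (λ i → F (suc i)) + ∑ (B ℕ.* suc p') (λ i → F (suc p' ℕ.+ i))
    ≡⟨ cong₂ (λ x y → F 0 + x + y) (∑-zero p' (λ i i<p' → h (suc i) (non-multiple i<p')))
                                   (∑-multiples (suc p') B _ (λ i p∤i → h _ (p∤i ∘ shift-back))) ⟩
  F 0 + 0ℤ + rest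
    ≡⟨ cong (_+ rest) (ℤP.+-identityʳ (F 0)) ⟩
  F 0 + rest
    ∎
  where
  rest : ℤ
  rest = ∑ B (λ j → F (suc p' ℕ.+ j ℕ.* suc p'))
  non-multiple : ∀ {i} → i < p' → ¬ suc p' ∣ suc i
  non-multiple i<p' p∣i = ℕP.<-irrefl refl (ℕP.<-≤-trans (s≤s i<p') (∣⇒≤ p∣i))
  shift-back : ∀ {i} → suc p' ∣ suc p' ℕ.+ i → suc p' ∣ i
  shift-back p∣p+i = ∣m+n∣m⇒∣n p∣p+i ∣-refl

𝟙 : ∀ {a} {A : Set a} → Dec A → ℤ
𝟙 (yes _) = 1ℤ
𝟙 (no  _) = 0ℤ

length-filter-∑ : ∀ {a} {A : Set a} {P : Pred A a} (P? : Decidable P) n (f : ℕ → A) →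
  + length (filter P? (applyUpTo f n)) ≡ ∑ n (λ i → 𝟙 (P? (f i)))
length-filter-∑ P? zero    f = refl
length-filter-∑ P? (suc n) f with P? (f 0)
... | yes _ = cong (_+_ 1ℤ) (length-filter-∑ P? n (λ i → f (suc i)))
... | no  _ = trans (length-filter-∑ P? n (λ i → f (suc i))) (sym (ℤP.+-identityˡ _))

-- Coefficient calculus for the list polynomials of Defs

coeff-+ : ∀ p q n → coeff (p +ₚ q) n ≡ coeff p n + coeff q n
coeff-+ []      q       n       = sym (ℤP.+-identityˡ _)
coeff-+ (a ∷ p) []      n       = sym (ℤP.+-identityʳ _)
coeff-+ (a ∷ p) (b ∷ q) zero    = refl
coeff-+ (a ∷ p) (b ∷ q) (suc n) = coeff-+ p q n

coeff-scale : ∀ a q n → coeff (map (a *_) q) n ≡ a * coeff q n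
coeff-scale a []      n       = sym (ℤP.*-zeroʳ a)
coeff-scale a (b ∷ q) zero    = refl
coeff-scale a (b ∷ q) (suc n) = coeff-scale a q n

coeff-neg : ∀ p n → coeff (-ₚ p) n ≡ - coeff p n
coeff-neg []      n       = refl
coeff-neg (a ∷ p) zero    = refl
coeff-neg (a ∷ p) (suc n) = coeff-neg p n

coeff-beyond : ∀ p {k} → length p ≤ k → coeff p k ≡ 0ℤ
coeff-beyond []      _       = refl
coeff-beyond (a ∷ p) (s≤s l) = coeff-beyond p l

shiftₚ : ℕ → Poly → Poly
shiftₚ K q = replicate K 0ℤ ++ q

coeff-shift-+ : ∀ K q j → coeff (shiftₚ K q) (K ℕ.+ j) ≡ coeff q j
coeff-shift-+ zero    q j = refl
coeff-shift-+ (suc K) q j = coeff-shift-+ K q j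

coeff-shift-< : ∀ K q {n} → n < K → coeff (shiftₚ K q) n ≡ 0ℤ
coeff-shift-< (suc K) q {zero}  _       = refl
coeff-shift-< (suc K) q {suc n} (s≤s l) = coeff-shift-< K q l

coeff-monomial-≢ : ∀ c K {j} → j ≢ K → coeff (monomial c K) j ≡ 0ℤ
coeff-monomial-≢ c zero    {zero}  j≢K = ⊥-elim (j≢K refl)
coeff-monomial-≢ c zero    {suc j} _   = refl
coeff-monomial-≢ c (suc K) {zero}  _   = refl
coeff-monomial-≢ c (suc K) {suc j} j≢K = coeff-monomial-≢ c K (j≢K ∘ cong suc)

coeff-monomial-scale : ∀ c K j → coeff (monomial c K) j ≡ c * coeff (monomial 1ℤ K) j
coeff-monomial-scale c zero    zero    = sym (ℤP.*-identityʳ c)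
coeff-monomial-scale c zero    (suc j) = sym (ℤP.*-zeroʳ c)
coeff-monomial-scale c (suc K) zero    = sym (ℤP.*-zeroʳ c)
coeff-monomial-scale c (suc K) (suc j) = coeff-monomial-scale c K j

coeff-monomial-shift : ∀ a c K j → coeff (monomial c (a ℕ.+ K)) (a ℕ.+ j) ≡ coeff (monomial c K) j
coeff-monomial-shift zero    c K j = refl
coeff-monomial-shift (suc a) c K j = coeff-monomial-shift a c K j

coeff-∷-* : ∀ a p q n → coeff ((a ∷ p) *ₚ q) n ≡ a * coeff q n + coeff (0ℤ ∷ (p *ₚ q)) n
coeff-∷-* a p q n = trans (coeff-+ (map (a *_) q) _ n) (cong (_+ _) (coeff-scale a q n))

coeff-*-distribʳ : ∀ p p' q n → coeff ((p +ₚ p') *ₚ q) n ≡ coeff (p *ₚ q) n + coeff (p' *ₚ q) n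
coeff-*-distribʳ []      p'       q n = sym (ℤP.+-identityˡ _)
coeff-*-distribʳ (a ∷ p) []       q n = sym (ℤP.+-identityʳ _)
coeff-*-distribʳ (a ∷ p) (b ∷ p') q n = begin
  coeff (((a + b) ∷ (p +ₚ p')) *ₚ q) n
    ≡⟨ coeff-∷-* (a + b) (p +ₚ p') q n ⟩
  (a + b) * coeff q n + coeff (0ℤ ∷ ((p +ₚ p') *ₚ q)) n
    ≡⟨ cong₂ _+_ (ℤP.*-distribʳ-+ (coeff q n) a b) (higher n) ⟩
  (a * coeff q n + b * coeff q n) + (coeff (0ℤ ∷ (p *ₚ q)) n + coeff (0ℤ ∷ (p' *ₚ q)) n)
    ≡⟨ +-interchange (a * coeff q n) (b * coeff q n) (coeff (0ℤ ∷ (p *ₚ q)) n) (coeff (0ℤ ∷ (p' *ₚ q)) n) ⟩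
  (a * coeff q n + coeff (0ℤ ∷ (p *ₚ q)) n) + (b * coeff q n + coeff (0ℤ ∷ (p' *ₚ q)) n)
    ≡⟨ sym (cong₂ _+_ (coeff-∷-* a p q n) (coeff-∷-* b p' q n)) ⟩
  coeff ((a ∷ p) *ₚ q) n + coeff ((b ∷ p') *ₚ q) n
    ∎
  where
  higher : ∀ n → coeff (0ℤ ∷ ((p +ₚ p') *ₚ q)) n ≡ coeff (0ℤ ∷ (p *ₚ q)) n + coeff (0ℤ ∷ (p' *ₚ q)) n
  higher zero    = refl
  higher (suc n) = coeff-*-distribʳ p p' q n

coeff-*-neg : ∀ p q n → coeff ((-ₚ p) *ₚ q) n ≡ - coeff (p *ₚ q) n
coeff-*-neg []      q n = refl
coeff-*-neg (a ∷ p) q n = begin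
  coeff (((- a) ∷ (-ₚ p)) *ₚ q) n                        ≡⟨ coeff-∷-* (- a) (-ₚ p) q n ⟩
  - a * coeff q n + coeff (0ℤ ∷ ((-ₚ p) *ₚ q)) n         ≡⟨ cong (_+_ (- a * coeff q n)) (higher n) ⟩
  - a * coeff q n + - coeff (0ℤ ∷ (p *ₚ q)) n            ≡⟨ negate a (coeff q n) _ ⟩
  - (a * coeff q n + coeff (0ℤ ∷ (p *ₚ q)) n)            ≡⟨ cong -_ (sym (coeff-∷-* a p q n)) ⟩
  - coeff ((a ∷ p) *ₚ q) n                               ∎
  where
  higher : ∀ n → coeff (0ℤ ∷ ((-ₚ p) *ₚ q)) n ≡ - coeff (0ℤ ∷ (p *ₚ q)) n
  higher zero    = refl
  higher (suc n) = coeff-*-neg p q n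
  negate : ∀ a c x → - a * c + - x ≡ - (a * c + x)
  negate = solve-∀

coeff-monomial-* : ∀ c K q n → coeff (monomial c K *ₚ q) n ≡ c * coeff (shiftₚ K q) n
coeff-monomial-* c zero    q n = begin
  coeff ((c ∷ []) *ₚ q) n                ≡⟨ coeff-∷-* c [] q n ⟩
  c * coeff q n + coeff (0ℤ ∷ []) n      ≡⟨ cong (_+_ (c * coeff q n)) (zero-poly n) ⟩
  c * coeff q n + 0ℤ                     ≡⟨ ℤP.+-identityʳ _ ⟩
  c * coeff q n                          ∎
  where
  zero-poly : ∀ n → coeff (0ℤ ∷ []) n ≡ 0ℤ
  zero-poly zero    = refl
  zero-poly (suc n) = refl
coeff-monomial-* c (suc K) q n = begin
  coeff ((0ℤ ∷ monomial c K) *ₚ q) n                       ≡⟨ coeff-∷-* 0ℤ (monomial c K) q n ⟩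
  0ℤ * coeff q n + coeff (0ℤ ∷ (monomial c K *ₚ q)) n      ≡⟨ ℤP.+-identityˡ _ ⟩
  coeff (0ℤ ∷ (monomial c K *ₚ q)) n                       ≡⟨ higher n ⟩
  c * coeff (shiftₚ (suc K) q) n                           ∎
  where
  higher : ∀ n → coeff (0ℤ ∷ (monomial c K *ₚ q)) n ≡ c * coeff (shiftₚ (suc K) q) n
  higher zero    = sym (ℤP.*-zeroʳ c)
  higher (suc n) = coeff-monomial-* c K q n

coeff-tabulate : ∀ (f : ℕ → ℤ) (g : ℕ → ℕ) N → (∀ j → N ≤ j → f (g j) ≡ 0ℤ) →
  ∀ j → coeff (map f (applyUpTo g N)) j ≡ f (g j)
coeff-tabulate f g zero    h j       = sym (h j z≤n)
coeff-tabulate f g (suc N) h zero    = refl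
coeff-tabulate f g (suc N) h (suc j) = coeff-tabulate f (g ∘ suc) N (λ i N≤i → h (suc i) (s≤s N≤i)) j

coeff-xᵐ-1-* : ∀ m h n → coeff (xᵐ-1 m *ₚ h) n ≡ coeff (shiftₚ m h) n + -1ℤ * coeff h n
coeff-xᵐ-1-* m h n = begin
  coeff ((monomial 1ℤ m +ₚ (-ₚ monomial 1ℤ 0)) *ₚ h) n
    ≡⟨ coeff-*-distribʳ (monomial 1ℤ m) (-ₚ monomial 1ℤ 0) h n ⟩
  coeff (monomial 1ℤ m *ₚ h) n + coeff ((-ₚ monomial 1ℤ 0) *ₚ h) n
    ≡⟨ cong₂ _+_ (coeff-monomial-* 1ℤ m h n)
                 (trans (coeff-*-neg (monomial 1ℤ 0) h n) (cong -_ (coeff-monomial-* 1ℤ 0 h n))) ⟩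
  1ℤ * coeff (shiftₚ m h) n + - (1ℤ * coeff h n)
    ≡⟨ cong₂ _+_ (ℤP.*-identityˡ (coeff (shiftₚ m h) n))
                 (trans (cong -_ (ℤP.*-identityˡ (coeff h n))) (sym (ℤP.-1*i≡-i (coeff h n)))) ⟩
  coeff (shiftₚ m h) n + -1ℤ * coeff h n
    ∎

coeff-xᵐ+1-* : ∀ m h n → coeff (xᵐ+1 m *ₚ h) n ≡ coeff (shiftₚ m h) n + 1ℤ * coeff h n
coeff-xᵐ+1-* m h n = begin
  coeff ((monomial 1ℤ m +ₚ monomial 1ℤ 0) *ₚ h) n
    ≡⟨ coeff-*-distribʳ (monomial 1ℤ m) (monomial 1ℤ 0) h n ⟩
  coeff (monomial 1ℤ m *ₚ h) n + coeff (monomial 1ℤ 0 *ₚ h) n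
    ≡⟨ cong₂ _+_ (coeff-monomial-* 1ℤ m h n) (coeff-monomial-* 1ℤ 0 h n) ⟩
  1ℤ * coeff (shiftₚ m h) n + 1ℤ * coeff h n
    ≡⟨ cong (_+ 1ℤ * coeff h n) (ℤP.*-identityˡ (coeff (shiftₚ m h) n)) ⟩
  coeff (shiftₚ m h) n + 1ℤ * coeff h n
    ∎

-- Residues modulo g = x^m + s, where m = suc m' and t = -s, so x^m ≡ t.

module Residues (s : ℤ) (m' : ℕ) where

  m : ℕ
  m = suc m'

  t : ℤ
  t = - s

  -- residue n c k = Σ_{j<n} t^j · c (k + j·m) for a coefficient sequence c;
  -- for k = r < m and n large this is the coefficient of x^r in the
  -- reduction of Σ_j c j · x^j modulo g.
  residue : ℕ → (ℕ → ℤ) → ℕ → ℤ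
  residue zero    c k = 0ℤ
  residue (suc n) c k = c k + t * residue n c (m ℕ.+ k)

  VanishesFrom : ℕ → (ℕ → ℤ) → Set
  VanishesFrom L c = ∀ j → L ≤ j → c j ≡ 0ℤ

  residue-beyond : ∀ {L c} n {k} → VanishesFrom L c → L ≤ k → residue n c k ≡ 0ℤ
  residue-beyond zero    vc L≤k = refl
  residue-beyond (suc n) {k} vc L≤k =
    trans (cong₂ (λ x y → x + t * y) (vc k L≤k) (residue-beyond n vc (ℕP.≤-trans L≤k (ℕP.m≤n+m k m))))
          (trans (ℤP.+-identityˡ _) (ℤP.*-zeroʳ t))

  residue-fuel : ∀ {L c} n n' {k} → VanishesFrom L c → L ≤ k ℕ.+ n → n ≤ n' →
    residue n c k ≡ residue n' c k
  residue-fuel zero    n'       vc L≤k _         =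
    sym (residue-beyond n' vc (ℕP.≤-trans L≤k (ℕP.≤-reflexive (ℕP.+-identityʳ _))))
  residue-fuel {c = c} (suc n) (suc n') {k} vc L≤k (s≤s n≤n') =
    cong (λ x → c k + t * x) (residue-fuel n n' vc (ℕP.≤-trans L≤k bound) n≤n')
    where
    bound : k ℕ.+ suc n ≤ m ℕ.+ k ℕ.+ n
    bound = ℕP.≤-trans (ℕP.≤-reflexive (ℕP.+-suc k n)) (ℕP.+-monoˡ-≤ n (s≤s (ℕP.m≤n+m k m')))

  residue-ext : ∀ n {c c'} k → (∀ j → c j ≡ c' j) → residue n c k ≡ residue n c' k
  residue-ext zero    k h = refl
  residue-ext (suc n) k h = cong₂ (λ x y → x + t * y) (h k) (residue-ext n (m ℕ.+ k) h)

  residue-+ : ∀ n c c' k → residue n (λ j → c j + c' j) k ≡ residue n c k + residue n c' k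
  residue-+ zero    c c' k = refl
  residue-+ (suc n) c c' k =
    trans (cong (λ x → c k + c' k + t * x) (residue-+ n c c' (m ℕ.+ k)))
          (regroup (c k) (c' k) t (residue n c (m ℕ.+ k)) (residue n c' (m ℕ.+ k)))
    where
    regroup : ∀ a b c x y → a + b + c * (x + y) ≡ a + c * x + (b + c * y)
    regroup = solve-∀

  residue-neg : ∀ n c k → residue n (λ j → - c j) k ≡ - residue n c k
  residue-neg zero    c k = refl
  residue-neg (suc n) c k =
    trans (cong (λ x → - c k + t * x) (residue-neg n c (m ℕ.+ k))) (regroup (c k) t (residue n c (m ℕ.+ k)))
    where
    regroup : ∀ a c x → - a + c * - x ≡ - (a + c * x)
    regroup = solve-∀

  residue-scale : ∀ n a c k → residue n (λ j → a * c j) k ≡ a * residue n c k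
  residue-scale zero    a c k = sym (ℤP.*-zeroʳ a)
  residue-scale (suc n) a c k =
    trans (cong (λ x → a * c k + t * x) (residue-scale n a c (m ℕ.+ k))) (regroup a (c k) t (residue n c (m ℕ.+ k)))
    where
    regroup : ∀ a b c x → a * b + c * (a * x) ≡ a * (b + c * x)
    regroup = solve-∀

  residue-shift : ∀ n c a k → residue n c (a ℕ.+ k) ≡ residue n (λ j → c (a ℕ.+ j)) k
  residue-shift zero    c a k = refl
  residue-shift (suc n) c a k = cong (λ x → c (a ℕ.+ k) + t * x) (begin
    residue n c (m ℕ.+ (a ℕ.+ k))            ≡⟨ cong (residue n c) (ℕP.+-comm m (a ℕ.+ k)) ⟩
    residue n c (a ℕ.+ k ℕ.+ m)              ≡⟨ cong (residue n c) (ℕP.+-assoc a k m) ⟩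
    residue n c (a ℕ.+ (k ℕ.+ m))            ≡⟨ residue-shift n c a (k ℕ.+ m) ⟩
    residue n (λ j → c (a ℕ.+ j)) (k ℕ.+ m)  ≡⟨ cong (residue n _) (ℕP.+-comm k m) ⟩
    residue n (λ j → c (a ℕ.+ j)) (m ℕ.+ k)  ∎)

  residue-sum : ∀ n k (τ : ℕ → Poly) d (f : ℕ → ℕ) →
    residue n (coeff (foldr _+ₚ_ [] (map τ (applyUpTo f d)))) k ≡ ∑ d (λ i → residue n (coeff (τ (f i))) k)
  residue-sum n k τ zero    f = residue-beyond n {k} (λ j _ → refl) z≤n
  residue-sum n k τ (suc d) f = begin
    residue n (coeff (τ (f 0) +ₚ rest)) k
      ≡⟨ residue-ext n k (coeff-+ (τ (f 0)) rest) ⟩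
    residue n (λ j → coeff (τ (f 0)) j + coeff rest j) k
      ≡⟨ residue-+ n (coeff (τ (f 0))) (coeff rest) k ⟩
    residue n (coeff (τ (f 0))) k + residue n (coeff rest) k
      ≡⟨ cong (_+_ (residue n (coeff (τ (f 0))) k)) (residue-sum n k τ d (f ∘ suc)) ⟩
    ∑ (suc d) (λ i → residue n (coeff (τ (f i))) k)
      ∎
    where
    rest : Poly
    rest = foldr _+ₚ_ [] (map τ (applyUpTo (f ∘ suc) d))

  residue-difference : ∀ n P Q k →
    residue n (coeff (P -ₚ Q)) k ≡ residue n (coeff P) k + - residue n (coeff Q) k
  residue-difference n P Q k = begin
    residue n (coeff (P -ₚ Q)) k
      ≡⟨ residue-ext n k (λ j → trans (coeff-+ P (-ₚ Q) j) (cong (_+_ (coeff P j)) (coeff-neg Q j))) ⟩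
    residue n (λ j → coeff P j + - coeff Q j) k
      ≡⟨ residue-+ n (coeff P) (λ j → - coeff Q j) k ⟩
    residue n (coeff P) k + residue n (λ j → - coeff Q j) k
      ≡⟨ cong (_+_ (residue n (coeff P) k)) (residue-neg n (coeff Q) k) ⟩
    residue n (coeff P) k + - residue n (coeff Q) k
      ∎

  monomial-vanishes : ∀ c K → VanishesFrom (suc K) (coeff (monomial c K))
  monomial-vanishes c K j K<j = coeff-monomial-≢ c K (λ j≡K → ℕP.<-irrefl (sym j≡K) K<j)

  -- Φ r K is the coefficient of x^r in x^K reduced modulo g.
  Φ : ℕ → ℕ → ℤ
  Φ r K = residue (suc K) (coeff (monomial 1ℤ K)) r

  residue-monomial : ∀ n c K r → K < n → residue n (coeff (monomial c K)) r ≡ c * Φ r K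
  residue-monomial n c K r K<n = begin
    residue n (coeff (monomial c K)) r
      ≡⟨ residue-ext n r (coeff-monomial-scale c K) ⟩
    residue n (λ j → c * coeff (monomial 1ℤ K) j) r
      ≡⟨ residue-scale n c (coeff (monomial 1ℤ K)) r ⟩
    c * residue n (coeff (monomial 1ℤ K)) r
      ≡⟨ cong (c *_) (sym (residue-fuel (suc K) n (monomial-vanishes 1ℤ K) (ℕP.m≤n+m (suc K) r) K<n)) ⟩
    c * Φ r K
      ∎

  -- Since x^m ≡ t, shifting the exponent by m multiplies by t.
  Φ-period : ∀ r K → r < m → Φ r (m ℕ.+ K) ≡ t * Φ r K
  Φ-period r K r<m =
    trans (cong₂ (λ x y → x + t * y) (coeff-monomial-≢ 1ℤ (m ℕ.+ K) r≢m+K) reduce) (ℤP.+-identityˡ _)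
    where
    r≢m+K : r ≢ m ℕ.+ K
    r≢m+K r≡m+K = ℕP.<-irrefl r≡m+K (ℕP.<-≤-trans r<m (ℕP.m≤m+n m K))
    reduce : residue (m ℕ.+ K) (coeff (monomial 1ℤ (m ℕ.+ K))) (m ℕ.+ r) ≡ Φ r K
    reduce = begin
      residue (m ℕ.+ K) (coeff (monomial 1ℤ (m ℕ.+ K))) (m ℕ.+ r)
        ≡⟨ residue-shift (m ℕ.+ K) (coeff (monomial 1ℤ (m ℕ.+ K))) m r ⟩
      residue (m ℕ.+ K) (λ j → coeff (monomial 1ℤ (m ℕ.+ K)) (m ℕ.+ j)) r
        ≡⟨ residue-ext (m ℕ.+ K) r (coeff-monomial-shift m 1ℤ K) ⟩
      residue (m ℕ.+ K) (coeff (monomial 1ℤ K)) r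
        ≡⟨ sym (residue-fuel (suc K) (m ℕ.+ K) (monomial-vanishes 1ℤ K) (ℕP.m≤n+m (suc K) r) (s≤s (ℕP.m≤n+m K m'))) ⟩
      Φ r K
        ∎

  -- If every residue
  -- of P vanishes, then g ∣ P, with quotient coefficients q_j = R (m + j),
  -- where R is the residue of P: the relation R k = P_k + t·R (m + k) says
  -- exactly that P = x^m·q + s·q.
  module _ (g : Poly) (g-spec : ∀ h n → coeff (g *ₚ h) n ≡ coeff (shiftₚ m h) n + s * coeff h n) where

    divisible : ∀ F P → length P < F → (∀ r → r < m → residue F (coeff P) r ≡ 0ℤ) → g ∣ₚ P
    divisible (suc F) P (s≤s L≤F) residues-vanish =
      quotient , λ n → trans (coeff-P n) (sym (g-spec quotient n))
      where
      R : ℕ → ℤ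
      R = residue (suc F) (coeff P)

      P-vanishes : VanishesFrom (length P) (coeff P)
      P-vanishes j L≤j = coeff-beyond P L≤j

      R-step : ∀ k → R k ≡ coeff P k + t * R (m ℕ.+ k)
      R-step k = cong (λ x → coeff P k + t * x)
        (residue-fuel F (suc F) P-vanishes (ℕP.≤-trans L≤F (ℕP.m≤n+m F (m ℕ.+ k))) (ℕP.n≤1+n F))

      quotient : Poly
      quotient = map (λ j → R (m ℕ.+ j)) (upTo (suc F))

      coeff-quotient : ∀ j → coeff quotient j ≡ R (m ℕ.+ j)
      coeff-quotient = coeff-tabulate (λ j → R (m ℕ.+ j)) (λ j → j) (suc F)
        (λ j F<j → residue-beyond (suc F) P-vanishes (ℕP.≤-trans L≤F (ℕP.≤-trans (ℕP.n≤1+n F) (ℕP.≤-trans F<j (ℕP.m≤n+m j m)))))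

      cancel : ∀ a x → a ≡ a + t * x + s * x
      cancel a x = cancel′ a s x
        where
        cancel′ : ∀ a s x → a ≡ a + - s * x + s * x
        cancel′ = solve-∀

      high : ∀ j → coeff P (m ℕ.+ j) ≡ coeff (shiftₚ m quotient) (m ℕ.+ j) + s * coeff quotient (m ℕ.+ j)
      high j = begin
        coeff P (m ℕ.+ j)
          ≡⟨ cancel (coeff P (m ℕ.+ j)) (R (m ℕ.+ (m ℕ.+ j))) ⟩
        coeff P (m ℕ.+ j) + t * R (m ℕ.+ (m ℕ.+ j)) + s * R (m ℕ.+ (m ℕ.+ j))
          ≡⟨ cong (_+ s * R (m ℕ.+ (m ℕ.+ j))) (sym (R-step (m ℕ.+ j))) ⟩
        R (m ℕ.+ j) + s * R (m ℕ.+ (m ℕ.+ j))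
          ≡⟨ sym (cong₂ (λ x y → x + s * y) (trans (coeff-shift-+ m quotient j) (coeff-quotient j)) (coeff-quotient (m ℕ.+ j))) ⟩
        coeff (shiftₚ m quotient) (m ℕ.+ j) + s * coeff quotient (m ℕ.+ j)
          ∎

      low : ∀ r → r < m → coeff P r ≡ coeff (shiftₚ m quotient) r + s * coeff quotient r
      low r r<m = begin
        coeff P r
          ≡⟨ cancel (coeff P r) (R (m ℕ.+ r)) ⟩
        coeff P r + t * R (m ℕ.+ r) + s * R (m ℕ.+ r)
          ≡⟨ cong (_+ s * R (m ℕ.+ r)) (trans (sym (R-step r)) (residues-vanish r r<m)) ⟩
        0ℤ + s * R (m ℕ.+ r)
          ≡⟨ sym (cong₂ (λ x y → x + s * y) (coeff-shift-< m quotient r<m) (coeff-quotient r)) ⟩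
        coeff (shiftₚ m quotient) r + s * coeff quotient r
          ∎

      coeff-P : ∀ n → coeff P n ≡ coeff (shiftₚ m quotient) n + s * coeff quotient n
      coeff-P n with m ℕ.≤? n
      ... | yes m≤n = subst (λ n → coeff P n ≡ coeff (shiftₚ m quotient) n + s * coeff quotient n)
                            (ℕP.m+[n∸m]≡n m≤n) (high (n ℕ.∸ m))
      ... | no  m≰n = low n (ℕP.≰⇒> m≰n)

-- Primes

prime>1 : ∀ {p} → Prime p → 1 < p
prime>1 {p} pp = ℕ.nonTrivial⇒n>1 p {{prime⇒nonTrivial pp}}

prime-∣-prime : ∀ {p q} → Prime p → Prime q → p ∣ q → p ≡ q
prime-∣-prime pp qq p∣q with prime⇒irreducible qq p∣q
... | inj₁ refl = ⊥-elim (ℕP.<-irrefl refl (prime>1 pp))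
... | inj₂ p≡q  = p≡q

prime-∣-^ : ∀ {p a} e → Prime p → p ∣ a ℕ.^ e → p ∣ a
prime-∣-^ zero    pp p∣1 = ⊥-elim (ℕP.<-irrefl (sym (∣1⇒≡1 p∣1)) (prime>1 pp))
prime-∣-^ {a = a} (suc e) pp p∣aᵉ⁺¹ with euclidsLemma a (a ℕ.^ e) pp p∣aᵉ⁺¹
... | inj₁ p∣a  = p∣a
... | inj₂ p∣aᵉ = prime-∣-^ e pp p∣aᵉ

cancel-prime : ∀ {p f X} → Prime p → ¬ p ∣ f → f ∣ p ℕ.* X → f ∣ X
cancel-prime {p} {f} pp p∤f = coprime-divisor f⊥p
  where
  f⊥p : Coprime f p
  f⊥p (i∣f , i∣p) with prime⇒irreducible pp i∣p
  ... | inj₁ i≡1 = i≡1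
  ... | inj₂ refl = ⊥-elim (p∤f i∣f)

cancel-prime-power : ∀ {p f X} b → Prime p → ¬ p ∣ f → f ∣ p ℕ.^ b ℕ.* X → f ∣ X
cancel-prime-power {X = X} zero pp p∤f f∣X = subst (_ ∣_) (ℕP.+-identityʳ X) f∣X
cancel-prime-power {p} {f} {X} (suc b) pp p∤f f∣pᵇ⁺¹X =
  cancel-prime-power b pp p∤f (cancel-prime pp p∤f (subst (f ∣_) (ℕP.*-assoc p (p ℕ.^ b) X) f∣pᵇ⁺¹X))

-- The Möbius function: μ(n) = 0 if p² ∣ n, and μ(p·g) = -μ(g) if p ∤ g.

SquareAt : ℕ → ℕ → Set
SquareAt n i = suc (suc i) ℕ.* suc (suc i) ∣ n

NoSquare : ℕ → Set
NoSquare n = ∀ i → i < n → ¬ SquareAt n i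

square-count : ℕ → ℕ
square-count n = length (filter (λ i → (suc (suc i) ℕ.* suc (suc i)) ∣? n) (upTo n))

square-count≡0⇒ : ∀ n → square-count n ≡ 0 → NoSquare n
square-count≡0⇒ n count≡0 i i<n sq =
  ℕP.<-irrefl (sym count≡0) (filter-some (λ i → (suc (suc i) ℕ.* suc (suc i)) ∣? n) (applyUpTo⁺ (λ j → j) sq i<n))

NoSquare⇒square-count≡0 : ∀ n → NoSquare n → square-count n ≡ 0
NoSquare⇒square-count≡0 n none =
  cong length (filter-none (λ i → (suc (suc i) ℕ.* suc (suc i)) ∣? n) (applyUpTo⁺₁ (λ j → j) n (none _)))

≟0-cong : ∀ a b → (a ≡ 0 → b ≡ 0) → (b ≡ 0 → a ≡ 0) → ⌊ a ℕ.≟ 0 ⌋ ≡ ⌊ b ℕ.≟ 0 ⌋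
≟0-cong zero    zero    _ _ = refl
≟0-cong (suc a) (suc b) _ _ = refl
≟0-cong zero    (suc b) a⇒b _ with () ← a⇒b refl
≟0-cong (suc a) zero    _ b⇒a with () ← b⇒a refl

squarefree-cong : ∀ a b → (NoSquare a → NoSquare b) → (NoSquare b → NoSquare a) → squarefree a ≡ squarefree b
squarefree-cong a b a⇒b b⇒a = ≟0-cong (square-count a) (square-count b)
  (λ e → NoSquare⇒square-count≡0 b (a⇒b (square-count≡0⇒ a e)))
  (λ e → NoSquare⇒square-count≡0 a (b⇒a (square-count≡0⇒ b e)))

squarefree-false : ∀ {n} i → i < n → SquareAt n i → squarefree n ≡ false
squarefree-false {n} i i<n sq with square-count n in count
... | zero  = ⊥-elim (square-count≡0⇒ n count i i<n sq)
... | suc _ = refl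

μ-square : ∀ {p n} → Prime p → 1 ≤ n → p ℕ.* p ∣ n → μ n ≡ 0ℤ
μ-square {p} {n} pp 1≤n p²∣n =
  cong (λ b → if b then -1ℤ ℤ.^ ω n else 0ℤ) (squarefree-false i i<n (subst (λ k → k ℕ.* k ∣ n) (sym i+2≡p) p²∣n))
  where
  i : ℕ
  i = p ℕ.∸ 2
  i+2≡p : suc (suc i) ≡ p
  i+2≡p = trans (ℕP.+-comm 2 i) (ℕP.m∸n+n≡m (prime>1 pp))
  i<n : i < n
  i<n = ℕP.<-≤-trans (subst (i <_) i+2≡p (ℕP.m<n⇒m<1+n (ℕP.n<1+n i)))
          (ℕP.≤-trans (ℕP.m≤m*n p p {{prime⇒nonZero pp}}) (∣⇒≤ {{ℕ.>-nonZero 1≤n}} p²∣n))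

square-cancel : ∀ {p g k} → Prime p → ¬ p ∣ g → k ℕ.* k ∣ p ℕ.* g → k ℕ.* k ∣ g
square-cancel {p} {g} {k} pp p∤g k²∣pg = cancel-prime pp p∤k² k²∣pg
  where
  instance _ = prime⇒nonZero pp
  p∤k² : ¬ p ∣ k ℕ.* k
  p∤k² p∣k² with euclidsLemma k k pp p∣k²
  ... | inj₁ p∣k = p∤g (*-cancelˡ-∣ p (∣-trans (*-pres-∣ p∣k p∣k) k²∣pg))
  ... | inj₂ p∣k = p∤g (*-cancelˡ-∣ p (∣-trans (*-pres-∣ p∣k p∣k) k²∣pg))

squarefree-prime-mul : ∀ {p g} → Prime p → 1 ≤ g → ¬ p ∣ g → squarefree (p ℕ.* g) ≡ squarefree g
squarefree-prime-mul {p} {g} pp 1≤g p∤g = squarefree-cong (p ℕ.* g) g pg⇒g g⇒pg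
  where
  instance _ = prime⇒nonZero pp
  instance _ = ℕ.>-nonZero 1≤g
  g≤pg : g ≤ p ℕ.* g
  g≤pg = ℕP.m≤n*m g p
  pg⇒g : NoSquare (p ℕ.* g) → NoSquare g
  pg⇒g none i i<g sq = none i (ℕP.<-≤-trans i<g g≤pg) (∣n⇒∣m*n p sq)
  g⇒pg : NoSquare g → NoSquare (p ℕ.* g)
  g⇒pg none i _ sq = none i i<g k²∣g
    where
    k²∣g = square-cancel {k = suc (suc i)} pp p∤g sq
    i<g : i < g
    i<g = ℕP.<-≤-trans (ℕP.≤-trans (ℕP.n≤1+n _) (ℕP.m≤m*n (suc (suc i)) (suc (suc i)))) (∣⇒≤ k²∣g)

𝟙-yes : ∀ {a} {A : Set a} → A → (d : Dec A) → 𝟙 d ≡ 1ℤ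
𝟙-yes x (yes _) = refl
𝟙-yes x (no ¬x) = ⊥-elim (¬x x)

𝟙-no : ∀ {a} {A : Set a} → ¬ A → (d : Dec A) → 𝟙 d ≡ 0ℤ
𝟙-no ¬x (yes x) = ⊥-elim (¬x x)
𝟙-no ¬x (no _)  = refl

𝟙-cong : ∀ {a b} {A : Set a} {B : Set b} → (A → B) → (B → A) → (d : Dec A) (e : Dec B) → 𝟙 d ≡ 𝟙 e
𝟙-cong A⇒B B⇒A (yes x) e = sym (𝟙-yes (A⇒B x) e)
𝟙-cong A⇒B B⇒A (no ¬x) e = sym (𝟙-no (¬x ∘ B⇒A) e)

ω-∑ : ∀ n → + ω n ≡ ∑ (suc n) (λ j → 𝟙 (prime? j ×-dec j ∣? n))
ω-∑ n = length-filter-∑ (λ j → prime? j ×-dec j ∣? n) (suc n) (λ j → j)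

prime-divisors-split : ∀ {p g} j → Prime p → ¬ p ∣ g →
  𝟙 (prime? j ×-dec j ∣? (p ℕ.* g)) ≡ 𝟙 (prime? j ×-dec j ∣? g) + 𝟙 (j ℕ.≟ p)
prime-divisors-split {p} {g} j pp p∤g with j ℕ.≟ p
... | yes refl =
  trans (𝟙-yes (pp , ∣m⇒∣m*n g ∣-refl) (prime? p ×-dec p ∣? (p ℕ.* g)))
        (cong (_+ 1ℤ) (sym (𝟙-no (λ (_ , p∣g) → p∤g p∣g) (prime? p ×-dec p ∣? g))))
... | no  j≢p  =
  trans (𝟙-cong from-pg to-pg (prime? j ×-dec j ∣? (p ℕ.* g)) (prime? j ×-dec j ∣? g))
        (sym (ℤP.+-identityʳ _))
  where
  from-pg : Prime j × j ∣ p ℕ.* g → Prime j × j ∣ g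
  from-pg (pj , j∣pg) with euclidsLemma p g pj j∣pg
  ... | inj₁ j∣p = ⊥-elim (j≢p (prime-∣-prime pj pp j∣p))
  ... | inj₂ j∣g = pj , j∣g
  to-pg : Prime j × j ∣ g → Prime j × j ∣ p ℕ.* g
  to-pg (pj , j∣g) = pj , ∣n⇒∣m*n p j∣g

∑-𝟙-≟ : ∀ B p → p < B → ∑ B (λ j → 𝟙 (j ℕ.≟ p)) ≡ 1ℤ
∑-𝟙-≟ (suc B) zero    _         = cong (_+_ 1ℤ) (∑-zero B (λ i _ → refl))
∑-𝟙-≟ (suc B) (suc p) (s≤s p<B) =
  trans (ℤP.+-identityˡ _)
        (trans (∑-ext B (λ i _ → 𝟙-cong ℕP.suc-injective (cong suc) (suc i ℕ.≟ suc p) (i ℕ.≟ p)))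
               (∑-𝟙-≟ B p p<B))

ω-prime-mul : ∀ {p g} → Prime p → 1 ≤ g → ¬ p ∣ g → ω (p ℕ.* g) ≡ suc (ω g)
ω-prime-mul {p} {g} pp 1≤g p∤g = ℤP.+-injective (begin
  + ω (p ℕ.* g)
    ≡⟨ ω-∑ (p ℕ.* g) ⟩
  ∑ (suc (p ℕ.* g)) (λ j → 𝟙 (prime? j ×-dec j ∣? (p ℕ.* g)))
    ≡⟨ ∑-ext (suc (p ℕ.* g)) (λ j _ → prime-divisors-split j pp p∤g) ⟩
  ∑ (suc (p ℕ.* g)) (λ j → 𝟙 (prime? j ×-dec j ∣? g) + 𝟙 (j ℕ.≟ p))
    ≡⟨ ∑-+ (suc (p ℕ.* g)) (λ j → 𝟙 (prime? j ×-dec j ∣? g)) (λ j → 𝟙 (j ℕ.≟ p)) ⟩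
  ∑ (suc (p ℕ.* g)) (λ j → 𝟙 (prime? j ×-dec j ∣? g)) + ∑ (suc (p ℕ.* g)) (λ j → 𝟙 (j ℕ.≟ p))
    ≡⟨ cong₂ _+_ (∑-truncate _ beyond-g (s≤s g≤pg)) (∑-𝟙-≟ (suc (p ℕ.* g)) p (s≤s (ℕP.m≤m*n p g))) ⟩
  ∑ (suc g) (λ j → 𝟙 (prime? j ×-dec j ∣? g)) + 1ℤ
    ≡⟨ cong (_+ 1ℤ) (sym (ω-∑ g)) ⟩
  + ω g + 1ℤ
    ≡⟨ ℤP.+-comm (+ ω g) 1ℤ ⟩
  + suc (ω g)
    ∎)
  where
  instance _ = ℕ.>-nonZero 1≤g
  g≤pg : g ≤ p ℕ.* g
  g≤pg = ℕP.m≤n*m g p {{prime⇒nonZero pp}}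
  beyond-g : ∀ j → suc g ≤ j → 𝟙 (prime? j ×-dec j ∣? g) ≡ 0ℤ
  beyond-g j g<j = 𝟙-no (λ (_ , j∣g) → ℕP.<-irrefl refl (ℕP.<-≤-trans (s≤s (∣⇒≤ j∣g)) g<j)) (prime? j ×-dec j ∣? g)

μ-prime-mul : ∀ {p g} → Prime p → 1 ≤ g → ¬ p ∣ g → μ (p ℕ.* g) ≡ - μ g
μ-prime-mul {p} {g} pp 1≤g p∤g =
  trans (cong₂ μ-formula (squarefree-prime-mul pp 1≤g p∤g) (ω-prime-mul pp 1≤g p∤g))
        (one-more-prime (squarefree g) (ω g))
  where
  μ-formula : Bool → ℕ → ℤ
  μ-formula b w = if b then -1ℤ ℤ.^ w else 0ℤ
  one-more-prime : ∀ b w → μ-formula b (suc w) ≡ - μ-formula b w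
  one-more-prime true  w = ℤP.-1*i≡-i _
  one-more-prime false w = refl

-- Möbius sums T N φ = Σ_{f ∣ N} μ(f) φ(N/f)

when unless : ∀ {a} {A : Set a} → Dec A → ℤ → ℤ
when   (yes _) x = x
when   (no  _) x = 0ℤ
unless (yes _) x = 0ℤ
unless (no  _) x = x

when-unless : ∀ {a} {A : Set a} (d : Dec A) x → x ≡ unless d x + when d x
when-unless (yes _) x = sym (ℤP.+-identityˡ x)
when-unless (no  _) x = sym (ℤP.+-identityʳ x)

when-no : ∀ {a} {A : Set a} (d : Dec A) {x} → ¬ A → when d x ≡ 0ℤ
when-no (yes a) ¬a = ⊥-elim (¬a a)
when-no (no  _) ¬a = refl

when-neg : ∀ {a} {A : Set a} (d : Dec A) x → - when d x ≡ when d (- x)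
when-neg (yes _) x = refl
when-neg (no  _) x = refl

when-cong : ∀ {a b} {A : Set a} {B : Set b} (d : Dec A) (e : Dec B) {x y} →
  (A → B) → (B → A) → (A → x ≡ y) → when d x ≡ when e y
when-cong (yes a) e A⇒B B⇒A x≡y with e
... | yes _ = x≡y a
... | no ¬b = ⊥-elim (¬b (A⇒B a))
when-cong (no ¬a) e A⇒B B⇒A x≡y = sym (when-no e (¬a ∘ B⇒A))

divisor-term : ℕ → (ℕ → ℤ) → ℕ → ℤ
divisor-term N φ zero    = 0ℤ
divisor-term N φ (suc f) = when (suc f ∣? N) (μ (suc f) * φ (N / suc f))

T : ℕ → (ℕ → ℤ) → ℤ
T N φ = ∑ (suc N) (divisor-term N φ)

T-ext : ∀ N {φ ψ} → (∀ K → φ K ≡ ψ K) → T N φ ≡ T N ψ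
T-ext N {φ} {ψ} φ≗ψ = ∑-ext (suc N) term
  where
  term : ∀ f → f < suc N → divisor-term N φ f ≡ divisor-term N ψ f
  term zero    _ = refl
  term (suc f) _ = cong (λ x → when (suc f ∣? N) (μ (suc f) * x)) (φ≗ψ (N / suc f))

T-range : ∀ {N B} φ → 1 ≤ N → suc N ≤ B → ∑ B (divisor-term N φ) ≡ T N φ
T-range {N} φ 1≤N = ∑-truncate (divisor-term N φ) beyond
  where
  beyond : ∀ f → suc N ≤ f → divisor-term N φ f ≡ 0ℤ
  beyond (suc f) N<f = when-no (suc f ∣? N) (λ f∣N → ℕP.<-irrefl refl (ℕP.<-≤-trans (s≤s (∣⇒≤ {{ℕ.>-nonZero 1≤N}} f∣N)) N<f))

∑-by-multiples : ∀ p .{{_ : NonZero p}} B (F : ℕ → ℤ) →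
  ∑ (B ℕ.* p) F ≡ ∑ (B ℕ.* p) (λ f → unless (p ∣? f) (F f)) + ∑ B (λ j → F (j ℕ.* p))
∑-by-multiples p B F = begin
  ∑ (B ℕ.* p) F
    ≡⟨ ∑-ext (B ℕ.* p) (λ f _ → when-unless (p ∣? f) (F f)) ⟩
  ∑ (B ℕ.* p) (λ f → unless (p ∣? f) (F f) + when (p ∣? f) (F f))
    ≡⟨ ∑-+ (B ℕ.* p) (λ f → unless (p ∣? f) (F f)) (λ f → when (p ∣? f) (F f)) ⟩
  ∑ (B ℕ.* p) (λ f → unless (p ∣? f) (F f)) + ∑ (B ℕ.* p) (λ f → when (p ∣? f) (F f))
    ≡⟨ cong (_+_ rest) (∑-multiples p B (λ f → when (p ∣? f) (F f)) (λ f p∤f → when-no (p ∣? f) p∤f)) ⟩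
  ∑ (B ℕ.* p) (λ f → unless (p ∣? f) (F f)) + ∑ B (λ j → when (p ∣? (j ℕ.* p)) (F (j ℕ.* p)))
    ≡⟨ cong (_+_ rest) (∑-ext B (λ j _ → multiple j (p ∣? (j ℕ.* p)))) ⟩
  ∑ (B ℕ.* p) (λ f → unless (p ∣? f) (F f)) + ∑ B (λ j → F (j ℕ.* p))
    ∎
  where
  rest : ℤ
  rest = ∑ (B ℕ.* p) (λ f → unless (p ∣? f) (F f))
  multiple : ∀ j (d : Dec (p ∣ j ℕ.* p)) → when d (F (j ℕ.* p)) ≡ F (j ℕ.* p)
  multiple j (yes _)   = refl
  multiple j (no p∤jp) = ⊥-elim (p∤jp (n∣m*n j))

-- Divisors f of p^{b+1} d' with p ∤ f
-- are the divisors of d'; those with p ∣ f are f = j p, where the term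
-- vanishes if p ∣ j (as p² ∣ f) and otherwise is minus the j-term of d'.
module MöbiusRecursion {p' : ℕ} (b : ℕ) {d' : ℕ} (φ : ℕ → ℤ)
                       (pp : Prime (suc p')) (p∤d' : ¬ suc p' ∣ d') (1≤d' : 1 ≤ d') where

  p : ℕ
  p = suc p'

  N : ℕ
  N = p ℕ.^ suc b ℕ.* d'

  instance
    _ : NonZero d'
    _ = ℕ.>-nonZero 1≤d'

  N≡ : N ≡ p ℕ.^ b ℕ.* d' ℕ.* p
  N≡ = trans (ℕP.*-assoc p (p ℕ.^ b) d') (ℕP.*-comm p (p ℕ.^ b ℕ.* d'))

  1≤N : 1 ≤ N
  1≤N = ℕP.≤-trans 1≤d' (ℕP.m≤n*m d' (p ℕ.^ suc b) {{ℕP.m^n≢0 p (suc b)}})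

  term-coprime : ∀ f → unless (p ∣? f) (divisor-term N φ f) ≡ divisor-term d' (λ K → φ (p ℕ.^ suc b ℕ.* K)) f
  term-coprime zero = lemma (p ∣? zero)
    where
    lemma : ∀ {a} {A : Set a} (d : Dec A) → unless d 0ℤ ≡ 0ℤ
    lemma (yes _) = refl
    lemma (no  _) = refl
  term-coprime (suc f) with p ∣? suc f
  ... | yes p∣f = sym (when-no (suc f ∣? d') (λ f∣d' → p∤d' (∣-trans p∣f f∣d')))
  ... | no  p∤f = when-cong (suc f ∣? N) (suc f ∣? d')
    (cancel-prime-power (suc b) pp p∤f) (∣n⇒∣m*n (p ℕ.^ suc b))
    (λ f∣N → cong (λ K → μ (suc f) * φ K)
                  (*-/-assoc (p ℕ.^ suc b) (cancel-prime-power (suc b) pp p∤f f∣N)))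

  term-multiple : ∀ j → divisor-term N φ (j ℕ.* p) ≡ - divisor-term d' (λ K → φ (p ℕ.^ b ℕ.* K)) j
  term-multiple zero = refl
  term-multiple (suc j) with p ∣? suc j
  ... | yes p∣j = trans (vanishes (suc j ℕ.* p ∣? N))
                        (sym (cong -_ (when-no (suc j ∣? d') (λ j∣d' → p∤d' (∣-trans p∣j j∣d')))))
    where
    μ≡0 : μ (suc j ℕ.* p) ≡ 0ℤ
    μ≡0 = μ-square pp (s≤s z≤n) (*-monoˡ-∣ p p∣j)
    vanishes : ∀ (d : Dec (suc j ℕ.* p ∣ N)) → when d (μ (suc j ℕ.* p) * φ (N / (suc j ℕ.* p))) ≡ 0ℤ
    vanishes (yes _) = trans (cong (_* φ (N / (suc j ℕ.* p))) μ≡0) (ℤP.*-zeroˡ (φ (N / (suc j ℕ.* p))))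
    vanishes (no  _) = refl
  ... | no  p∤j = trans
    (when-cong (suc j ℕ.* p ∣? N) (suc j ∣? d') jp∣N⇒j∣d' j∣d'⇒jp∣N term)
    (sym (when-neg (suc j ∣? d') _))
    where
    jp∣N⇒j∣d' : suc j ℕ.* p ∣ N → suc j ∣ d'
    jp∣N⇒j∣d' jp∣N = cancel-prime-power b pp p∤j (*-cancelʳ-∣ p (subst (suc j ℕ.* p ∣_) N≡ jp∣N))
    j∣d'⇒jp∣N : suc j ∣ d' → suc j ℕ.* p ∣ N
    j∣d'⇒jp∣N j∣d' = subst (suc j ℕ.* p ∣_) (sym N≡) (*-monoˡ-∣ p (∣n⇒∣m*n (p ℕ.^ b) j∣d'))
    term : suc j ℕ.* p ∣ N →
      μ (suc j ℕ.* p) * φ (N / (suc j ℕ.* p)) ≡ - (μ (suc j) * φ (p ℕ.^ b ℕ.* (d' / suc j)))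
    term jp∣N = begin
      μ (suc j ℕ.* p) * φ (N / (suc j ℕ.* p))
        ≡⟨ cong₂ (λ x K → x * φ K) (trans (cong μ (ℕP.*-comm (suc j) p)) (μ-prime-mul pp (s≤s z≤n) p∤j)) quotient ⟩
      - μ (suc j) * φ (p ℕ.^ b ℕ.* (d' / suc j))
        ≡⟨ sym (ℤP.neg-distribˡ-* (μ (suc j)) _) ⟩
      - (μ (suc j) * φ (p ℕ.^ b ℕ.* (d' / suc j)))
        ∎
      where
      quotient : N / (suc j ℕ.* p) ≡ p ℕ.^ b ℕ.* (d' / suc j)
      quotient = begin
        N / (suc j ℕ.* p)                   ≡⟨ /-congˡ N≡ ⟩
        p ℕ.^ b ℕ.* d' ℕ.* p / (suc j ℕ.* p) ≡⟨ m*n/o*n≡m/o (p ℕ.^ b ℕ.* d') p (suc j) ⟩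
        p ℕ.^ b ℕ.* d' / suc j               ≡⟨ *-/-assoc (p ℕ.^ b) (jp∣N⇒j∣d' jp∣N) ⟩
        p ℕ.^ b ℕ.* (d' / suc j)             ∎

  T-recursion : T N φ ≡ T d' (λ K → φ (p ℕ.^ suc b ℕ.* K)) + - T d' (λ K → φ (p ℕ.^ b ℕ.* K))
  T-recursion = begin
    T N φ
      ≡⟨ sym (T-range φ 1≤N (ℕP.m≤m*n (suc N) p)) ⟩
    ∑ (suc N ℕ.* p) (divisor-term N φ)
      ≡⟨ ∑-by-multiples p (suc N) (divisor-term N φ) ⟩
    ∑ (suc N ℕ.* p) (λ f → unless (p ∣? f) (divisor-term N φ f)) + ∑ (suc N) (λ j → divisor-term N φ (j ℕ.* p))
      ≡⟨ cong₂ _+_ (∑-ext (suc N ℕ.* p) (λ f _ → term-coprime f)) (∑-ext (suc N) (λ j _ → term-multiple j)) ⟩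
    ∑ (suc N ℕ.* p) (divisor-term d' ψ₁) + ∑ (suc N) (λ j → - divisor-term d' ψ₀ j)
      ≡⟨ cong₂ _+_ (T-range ψ₁ 1≤d' (ℕP.≤-trans (s≤s d'≤N) (ℕP.m≤m*n (suc N) p)))
                   (trans (∑-neg (suc N) (divisor-term d' ψ₀)) (cong -_ (T-range ψ₀ 1≤d' (s≤s d'≤N)))) ⟩
    T d' ψ₁ + - T d' ψ₀
      ∎
    where
    ψ₁ ψ₀ : ℕ → ℤ
    ψ₁ K = φ (p ℕ.^ suc b ℕ.* K)
    ψ₀ K = φ (p ℕ.^ b ℕ.* K)
    d'≤N : d' ≤ N
    d'≤N = ℕP.m≤n*m d' (p ℕ.^ suc b) {{ℕP.m^n≢0 p (suc b)}}

-- The recursion for an arbitrary prime p (p = 0 is not prime).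
T-recursion : ∀ {p} b {d'} φ → Prime p → ¬ p ∣ d' → 1 ≤ d' →
  T (p ℕ.^ suc b ℕ.* d') φ ≡ T d' (λ K → φ (p ℕ.^ suc b ℕ.* K)) + - T d' (λ K → φ (p ℕ.^ b ℕ.* K))
T-recursion {zero}   b φ pp        with () ← prime>1 pp
T-recursion {suc p'} b φ pp p∤d' 1≤d' = MöbiusRecursion.T-recursion b φ pp p∤d' 1≤d'

-- Periodic test functions

Periodic : ℕ → (ℕ → ℤ) → Set
Periodic M φ = ∀ K → φ (M ℕ.+ K) ≡ φ K

module _ {M : ℕ} .{{_ : NonZero M}} where

  periodic-% : ∀ {φ} → Periodic M φ → ∀ K → φ K ≡ φ (K % M)
  periodic-% {φ} per K = begin
    φ K                          ≡⟨ cong φ (m≡m%n+[m/n]*n K M) ⟩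
    φ (K % M ℕ.+ K / M ℕ.* M)    ≡⟨ cong φ (ℕP.+-comm (K % M) (K / M ℕ.* M)) ⟩
    φ (K / M ℕ.* M ℕ.+ K % M)    ≡⟨ drop (K / M) (K % M) ⟩
    φ (K % M)                    ∎
    where
    drop : ∀ q x → φ (q ℕ.* M ℕ.+ x) ≡ φ x
    drop zero    x = refl
    drop (suc q) x = trans (cong φ (ℕP.+-assoc M (q ℕ.* M) x)) (trans (per _) (drop q x))

  periodic-cong : ∀ {φ} → Periodic M φ → ∀ {a b} → a % M ≡ b % M → φ a ≡ φ b
  periodic-cong {φ} per {a} {b} a≡b = trans (periodic-% per a) (trans (cong φ a≡b) (sym (periodic-% per b)))

  dilate-periodic : ∀ {φ} → Periodic M φ → ∀ c → Periodic M (λ K → φ (c ℕ.* K))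
  dilate-periodic per c K = periodic-cong per (begin
    (c ℕ.* (M ℕ.+ K)) % M        ≡⟨ cong (_% M) (trans (ℕP.*-distribˡ-+ c M K) (ℕP.+-comm (c ℕ.* M) (c ℕ.* K))) ⟩
    (c ℕ.* K ℕ.+ c ℕ.* M) % M    ≡⟨ [m+kn]%n≡m%n (c ℕ.* K) c M ⟩
    (c ℕ.* K) % M                ∎)

  dilate-cong : ∀ {φ} → Periodic M φ → ∀ {c c'} → c % M ≡ c' % M → ∀ K → φ (c ℕ.* K) ≡ φ (c' ℕ.* K)
  dilate-cong per {c} {c'} c≡c' K = periodic-cong per (begin
    (c ℕ.* K) % M                 ≡⟨ %-distribˡ-* c K M ⟩
    ((c % M) ℕ.* (K % M)) % M     ≡⟨ cong (λ x → (x ℕ.* (K % M)) % M) c≡c' ⟩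
    ((c' % M) ℕ.* (K % M)) % M    ≡⟨ sym (%-distribˡ-* c' K M) ⟩
    (c' ℕ.* K) % M                ∎)

  ^-cong-% : ∀ {a b} e → a % M ≡ b % M → (a ℕ.^ e) % M ≡ (b ℕ.^ e) % M
  ^-cong-% zero    a≡b = refl
  ^-cong-% {a} {b} (suc e) a≡b = begin
    (a ℕ.* a ℕ.^ e) % M                  ≡⟨ %-distribˡ-* a (a ℕ.^ e) M ⟩
    ((a % M) ℕ.* ((a ℕ.^ e) % M)) % M    ≡⟨ cong₂ (λ x y → (x ℕ.* y) % M) a≡b (^-cong-% e a≡b) ⟩
    ((b % M) ℕ.* ((b ℕ.^ e) % M)) % M    ≡⟨ sym (%-distribˡ-* b (b ℕ.^ e) M) ⟩
    (b ℕ.* b ℕ.^ e) % M                  ∎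

  modℕ⇒% : ∀ a b → a ≡ b [modℕ M ] → a % M ≡ b % M
  modℕ⇒% a b M∣a-b with ℕP.≤-total a b
  ... | inj₁ a≤b = sym (trans (cong (_% M) (sym (ℕP.m+[n∸m]≡n a≤b))) (%-remove-+ʳ a M∣b∸a))
    where
    M∣b∸a : M ∣ b ℕ.∸ a
    M∣b∸a = subst (M ∣_) (trans (cong ℤ.∣_∣ (ℤP.m-n≡m⊖n a b)) (ℤP.∣⊖∣-≤ a≤b)) M∣a-b
  ... | inj₂ b≤a = trans (cong (_% M) (sym (ℕP.m+[n∸m]≡n b≤a))) (%-remove-+ʳ b M∣a∸b)
    where
    M∣a∸b : M ∣ a ℕ.∸ b
    M∣a∸b = subst (M ∣_) (trans (cong ℤ.∣_∣ (ℤP.m-n≡m⊖n a b)) (trans (ℤP.∣m⊖n∣≡∣n⊖m∣ a b) (ℤP.∣⊖∣-≤ b≤a))) M∣a-b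

-- Primewise invariance of Möbius sums at periodic test functions

prime-∤-product : ∀ {P} k (r e : Fin k → ℕ) → Prime P → (∀ i → Prime (r i)) → (∀ i → P ≢ r i) →
  ¬ P ∣ prodFin k (λ i → r i ℕ.^ e i)
prime-∤-product zero    r e pP pr P≢r P∣1 = ℕP.<-irrefl (sym (∣1⇒≡1 P∣1)) (prime>1 pP)
prime-∤-product (suc k) r e pP pr P≢r P∣Π with euclidsLemma (r Fin.zero ℕ.^ e Fin.zero) _ pP P∣Π
... | inj₁ P∣r₀ = P≢r Fin.zero (prime-∣-prime pP (pr Fin.zero) (prime-∣-^ (e Fin.zero) pP P∣r₀))
... | inj₂ P∣Π' = prime-∤-product k (r ∘ Fin.suc) (e ∘ Fin.suc) pP (pr ∘ Fin.suc) (P≢r ∘ Fin.suc) P∣Π'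

product-positive : ∀ k (r e : Fin k → ℕ) → (∀ i → Prime (r i)) → 1 ≤ prodFin k (λ i → r i ℕ.^ e i)
product-positive zero    r e pr = s≤s z≤n
product-positive (suc k) r e pr =
  ℕP.*-mono-≤ (ℕP.m^n>0 (r Fin.zero) {{prime⇒nonZero (pr Fin.zero)}} (e Fin.zero))
              (product-positive k (r ∘ Fin.suc) (e ∘ Fin.suc) (pr ∘ Fin.suc))

module _ {M : ℕ} .{{_ : NonZero M}} where

  prime-power-step : ∀ {p q d' e'} → Prime p → Prime q → ¬ p ∣ d' → ¬ q ∣ e' → 1 ≤ d' → 1 ≤ e' →
    p % M ≡ q % M → (∀ ψ → Periodic M ψ → T d' ψ ≡ T e' ψ) →
    ∀ a φ → Periodic M φ → T (p ℕ.^ a ℕ.* d') φ ≡ T (q ℕ.^ a ℕ.* e') φ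
  prime-power-step {p} {q} {d'} {e'} pp qq p∤d' q∤e' 1≤d' 1≤e' p≡q same zero φ per = begin
    T (1 ℕ.* d') φ    ≡⟨ cong (λ n → T n φ) (ℕP.*-identityˡ d') ⟩
    T d' φ            ≡⟨ same φ per ⟩
    T e' φ            ≡⟨ cong (λ n → T n φ) (sym (ℕP.*-identityˡ e')) ⟩
    T (1 ℕ.* e') φ    ∎
  prime-power-step {p} {q} {d'} {e'} pp qq p∤d' q∤e' 1≤d' 1≤e' p≡q same (suc b) φ per = begin
    T (p ℕ.^ suc b ℕ.* d') φ
      ≡⟨ T-recursion b φ pp p∤d' 1≤d' ⟩
    T d' (λ K → φ (p ℕ.^ suc b ℕ.* K)) + - T d' (λ K → φ (p ℕ.^ b ℕ.* K))
      ≡⟨ cong₂ (λ x y → x + - y) (dilated (suc b)) (dilated b) ⟩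
    T e' (λ K → φ (q ℕ.^ suc b ℕ.* K)) + - T e' (λ K → φ (q ℕ.^ b ℕ.* K))
      ≡⟨ sym (T-recursion b φ qq q∤e' 1≤e') ⟩
    T (q ℕ.^ suc b ℕ.* e') φ
      ∎
    where
    dilated : ∀ c → T d' (λ K → φ (p ℕ.^ c ℕ.* K)) ≡ T e' (λ K → φ (q ℕ.^ c ℕ.* K))
    dilated c = trans (same (λ K → φ (p ℕ.^ c ℕ.* K)) (dilate-periodic per (p ℕ.^ c)))
                      (T-ext e' (dilate-cong per (^-cong-% c p≡q)))

  primewise-invariance : ∀ k (p q ex : Fin k → ℕ) → (∀ i → Prime (p i)) → (∀ i → Prime (q i)) →
    Injective _≡_ _≡_ p → Injective _≡_ _≡_ q → (∀ i → p i % M ≡ q i % M) →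
    ∀ φ → Periodic M φ → T (prodFin k (λ i → p i ℕ.^ ex i)) φ ≡ T (prodFin k (λ i → q i ℕ.^ ex i)) φ
  primewise-invariance zero    p q ex pp qq p-inj q-inj p≡q φ per = refl
  primewise-invariance (suc k) p q ex pp qq p-inj q-inj p≡q =
    prime-power-step (pp Fin.zero) (qq Fin.zero) (distinct p pp p-inj) (distinct q qq q-inj)
      (product-positive k (p ∘ Fin.suc) (ex ∘ Fin.suc) (pp ∘ Fin.suc))
      (product-positive k (q ∘ Fin.suc) (ex ∘ Fin.suc) (qq ∘ Fin.suc))
      (p≡q Fin.zero)
      (primewise-invariance k (p ∘ Fin.suc) (q ∘ Fin.suc) (ex ∘ Fin.suc) (pp ∘ Fin.suc) (qq ∘ Fin.suc)
        (FinP.suc-injective ∘ p-inj) (FinP.suc-injective ∘ q-inj) (p≡q ∘ Fin.suc))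
      (ex Fin.zero)
    where
    distinct : ∀ (r : Fin (suc k) → ℕ) → (∀ i → Prime (r i)) → Injective _≡_ _≡_ r →
      ¬ r Fin.zero ∣ prodFin k (λ i → r (Fin.suc i) ℕ.^ ex (Fin.suc i))
    distinct r pr r-inj = prime-∤-product k (r ∘ Fin.suc) (ex ∘ Fin.suc) (pr Fin.zero) (pr ∘ Fin.suc)
      (λ i r₀≡rᵢ → FinP.0≢1+n (r-inj r₀≡rᵢ))

  primewise-congruent⇒T≡ : ∀ {d e} → PrimewiseCongruent M d e → ∀ φ → Periodic M φ → T d φ ≡ T e φ
  primewise-congruent⇒T≡ (k , _ , p , q , ex , pp , qq , p-inj , q-inj , p≡q , refl , refl) =
    primewise-invariance k p q ex pp qq p-inj q-inj (λ i → modℕ⇒% (p i) (q i) (p≡q i))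

-- Residues of S_d, and the theorem

S-term : ℕ → ℕ → Poly
S-term d i with suc i ∣? d
... | yes _ = monomial (μ (suc i)) (d / suc i)
... | no  _ = []

-- The summand used in Defs is a local helper and cannot be named here; its
-- occurrence on the left of S-summand is inferred from S-unfold.
mutual
  S-unfold : ∀ d → S d ≡ foldr _+ₚ_ [] (map (S-term d) (upTo d))
  S-unfold d = cong (foldr _+ₚ_ []) (map-cong (S-summand d) (upTo d))

  S-summand : ∀ d i → _ ≡ S-term d i
  S-summand d i with suc i ∣? d
  ... | yes _ = refl
  ... | no  _ = refl

module _ (s : ℤ) (m' : ℕ) where
  open Residues s m'

  residue-S : ∀ F d r → d < F → residue F (coeff (S d)) r ≡ T d (Φ r)
  residue-S F d r d<F = begin
    residue F (coeff (S d)) r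
      ≡⟨ cong (λ P → residue F (coeff P) r) (S-unfold d) ⟩
    residue F (coeff (foldr _+ₚ_ [] (map (S-term d) (upTo d)))) r
      ≡⟨ residue-sum F r (S-term d) d (λ i → i) ⟩
    ∑ d (λ i → residue F (coeff (S-term d i)) r)
      ≡⟨ ∑-ext d (λ i _ → residue-term i) ⟩
    ∑ d (λ i → divisor-term d (Φ r) (suc i))
      ≡⟨ sym (ℤP.+-identityˡ _) ⟩
    T d (Φ r)
      ∎
    where
    residue-term : ∀ i → residue F (coeff (S-term d i)) r ≡ divisor-term d (Φ r) (suc i)
    residue-term i with suc i ∣? d
    ... | yes _ = residue-monomial F (μ (suc i)) (d / suc i) r (ℕP.≤-<-trans (m/n≤m d (suc i)) d<F)
    ... | no  _ = residue-beyond F {r} (λ j _ → refl) z≤n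

  S-congruence : ∀ g → (∀ h n → coeff (g *ₚ h) n ≡ coeff (shiftₚ m h) n + s * coeff h n) →
    ∀ d e → (∀ r → r < m → T d (Φ r) ≡ T e (Φ r)) → S d ≡ₚ S e [mod g ]
  S-congruence g g-spec d e T≡ = divisible g g-spec F (S d -ₚ S e) L<F residues-vanish
    where
    L F : ℕ
    L = length (S d -ₚ S e)
    F = suc (L ℕ.+ (d ℕ.+ e))
    L<F : L < F
    L<F = s≤s (ℕP.m≤m+n L (d ℕ.+ e))
    residues-vanish : ∀ r → r < m → residue F (coeff (S d -ₚ S e)) r ≡ 0ℤ
    residues-vanish r r<m = begin
      residue F (coeff (S d -ₚ S e)) r
        ≡⟨ residue-difference F (S d) (S e) r ⟩
      residue F (coeff (S d)) r + - residue F (coeff (S e)) r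
        ≡⟨ cong₂ (λ x y → x + - y) (residue-S F d r d<F) (residue-S F e r e<F) ⟩
      T d (Φ r) + - T e (Φ r)
        ≡⟨ cong (λ x → T d (Φ r) + - x) (sym (T≡ r r<m)) ⟩
      T d (Φ r) + - T d (Φ r)
        ≡⟨ ℤP.+-inverseʳ (T d (Φ r)) ⟩
      0ℤ
        ∎
      where
      d<F : d < F
      d<F = s≤s (ℕP.≤-trans (ℕP.m≤m+n d e) (ℕP.m≤n+m (d ℕ.+ e) L))
      e<F : e < F
      e<F = s≤s (ℕP.≤-trans (ℕP.m≤n+m e d) (ℕP.m≤n+m (d ℕ.+ e) L))

Φ-periodic-xᵐ-1 : ∀ m' r → r < suc m' → Periodic (suc m') (Residues.Φ -1ℤ m' r)
Φ-periodic-xᵐ-1 m' r r<m K = trans (Residues.Φ-period -1ℤ m' r K r<m) (ℤP.*-identityˡ _)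

Φ-periodic-xᵐ+1 : ∀ m' r → r < suc m' → Periodic (2 ℕ.* suc m') (Residues.Φ 1ℤ m' r)
Φ-periodic-xᵐ+1 m' r r<m K = begin
  Φ r (2 ℕ.* m ℕ.+ K)          ≡⟨ cong (Φ r) (ℕP.+-assoc m (m ℕ.+ 0) K) ⟩
  Φ r (m ℕ.+ (m ℕ.+ 0 ℕ.+ K))  ≡⟨ cong (λ n → Φ r (m ℕ.+ (n ℕ.+ K))) (ℕP.+-identityʳ m) ⟩
  Φ r (m ℕ.+ (m ℕ.+ K))        ≡⟨ Φ-period r (m ℕ.+ K) r<m ⟩
  -1ℤ * Φ r (m ℕ.+ K)          ≡⟨ cong (-1ℤ *_) (Φ-period r K r<m) ⟩
  -1ℤ * (-1ℤ * Φ r K)          ≡⟨ sym (ℤP.*-assoc -1ℤ -1ℤ (Φ r K)) ⟩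
  1ℤ * Φ r K                   ≡⟨ ℤP.*-identityˡ (Φ r K) ⟩
  Φ r K                        ∎
  where open Residues 1ℤ m'

theorem2p11 : (m d e : ℕ) → 1 ≤ m → 1 ≤ d → 1 ≤ e →
    (PrimewiseCongruent m d e → S d ≡ₚ S e [mod xᵐ-1 m ]) ×
    (PrimewiseCongruent (2 ℕ.* m) d e → S d ≡ₚ S e [mod xᵐ+1 m ])
theorem2p11 (suc m') d e _ _ _ = modulo-xᵐ-1 , modulo-xᵐ+1
  where
  modulo-xᵐ-1 : PrimewiseCongruent (suc m') d e → S d ≡ₚ S e [mod xᵐ-1 (suc m') ]
  modulo-xᵐ-1 d≈e = S-congruence -1ℤ m' (xᵐ-1 (suc m')) (coeff-xᵐ-1-* (suc m')) d e
    (λ r r<m → primewise-congruent⇒T≡ d≈e (Residues.Φ -1ℤ m' r) (Φ-periodic-xᵐ-1 m' r r<m))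
  modulo-xᵐ+1 : PrimewiseCongruent (2 ℕ.* suc m') d e → S d ≡ₚ S e [mod xᵐ+1 (suc m') ]
  modulo-xᵐ+1 d≈e = S-congruence 1ℤ m' (xᵐ+1 (suc m')) (coeff-xᵐ+1-* (suc m')) d e
    (λ r r<m → primewise-congruent⇒T≡ d≈e (Residues.Φ 1ℤ m' r) (Φ-periodic-xᵐ+1 m' r r<m))
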